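{- For any integers $\ell > 2$ and $t > 2$, \[ r(t;\ell) \geq \mathbb P(t,t)^{ -\frac{\ell-2}{t}}\, 2^{\frac{t-1}{2}} .\]
   Context: For natural numbers $t,\ell$, $r(t;\ell)$ is the minimum $r$ such that every $\ell$-coloring of the edges of $K_r$ contains a monochromatic clique on $t$ vertices. All graphs are finite simple graphs with at least one vertex. For integers $s \geq 1$ and $t \geq 2$, $\mathbb P(s,t)$ is the infimum, over all graphs $G$ containing no clique on $t$ vertices, of the probability that, when $v_1,\dots,v_s$ are vertices of $G$ chosen independently and uniformly at random (repetitions allowed), the set $\{v_1,\dots,v_s\}$ is an independent set of $G$ (no two of its elements are adjacent). -}

module Defs where

open import Data.Nat using (ℕ; zero; suc; _<_; _≥_; _*_; _^_; _∸_)
open import Data.Fin using (Fin)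
open import Data.Bool using (Bool; true; false; not; _∧_)
open import Data.List using (List; []; _∷_; map; concatMap; filter; length; foldr)
open import Data.Vec using (Vec; []; _∷_; toList)
open import Data.Product using (Σ; ∃; _×_; _,_)
open import Relation.Binary.PropositionalEquality using (_≡_; _≢_)
open import Relation.Nullary using (¬_)
open import Function.Definitions using (Injective)
open import Data.List using (allFin)

record Graph (n : ℕ) : Set where
  field
    adj   : Fin n → Fin n → Bool
    sym   : ∀ u v → adj u v ≡ adj v u
    irrefl : ∀ v → adj v v ≡ false
open Graph public

HasClique : ∀ {n} → Graph n → ℕ → Set
HasClique {n} G t =
  Σ (Fin t → Fin n) λ f → Injective _≡_ _≡_ f × (∀ i j → i ≢ j → adj G (f i) (f j) ≡ true)

tuples : (s n : ℕ) → List (Vec (Fin n) s)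
tuples zero    n = [] ∷ []
tuples (suc s) n = concatMap (λ v → map (v ∷_) (tuples s n)) (allFin n)

allB : {A : Set} → (A → Bool) → List A → Bool
allB p = foldr (λ x b → p x ∧ b) true

isIndependent : ∀ {n s} → Graph n → Vec (Fin n) s → Bool
isIndependent G vs =
  allB (λ x → allB (λ y → not (adj G x y)) (toList vs)) (toList vs)

-- Number of s-tuples whose underlying set is independent; the probability
-- in the definition of P(s,t) for G is  indepCount s G / n ^ s.
indepCount : ∀ {n} → (s : ℕ) → Graph n → ℕ
indepCount {n} s G = length (filter (λ vs → isIndependent G vs Data.Bool.≟ true) (tuples s n))
  where import Data.Bool

-- Every ℓ-coloring of the edges of K_r contains a monochromatic K_t.
-- An edge coloring is a symmetric map c : Fin r → Fin r → Fin ℓ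
-- (the values c i i on the diagonal are irrelevant).
RamseyProperty : (t ℓ r : ℕ) → Set
RamseyProperty t ℓ r =
  (c : Fin r → Fin r → Fin ℓ) → (∀ i j → c i j ≡ c j i) →
  Σ (Fin t → Fin r) λ f → Injective _≡_ _≡_ f ×
    Σ (Fin ℓ) λ k → ∀ i j → i ≢ j → c (f i) (f j) ≡ k

IsRamseyNumber : (t ℓ r : ℕ) → Set
IsRamseyNumber t ℓ r = RamseyProperty t ℓ r × (∀ r′ → r′ < r → ¬ RamseyProperty t ℓ r′)

{-# OPTIONS --safe #-}

-- Double counting over a random colouring of K_r with ℓ = L + 2 colours: choose maps
-- f₁, …, f_L : [r] → V(G) and an r × r 0/1 matrix, give ab the least i with f_i a ~ f_i b, and
-- otherwise colour L or L + 1 according to the xor of the entries (a, b) and (b, a) of the matrix.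
-- A monochromatic K_t in colour i < L would map to a K_t in G, so it has a bit colour: every f_i
-- maps it to an independent set and its bits are constant. For a fixed distinct t-tuple x and bit
-- colour this happens with probability (I / N^t)^L · 2^(-t(t-1)/2), where I counts the independent
-- t-tuples of G. Since r = r(t; ℓ), every colouring has such an x with x₀ < x₁; there are at most
-- r^t / 2 of those, so r^t (I / N^t)^L 2^(-t(t-1)/2) ≥ 1.

module Submission where

open import Defs hiding (sym)

import Algebra.Properties.CommutativeSemigroup as CommSemigroupProperties
open import Data.Bool using (Bool; true; false; not; _∧_; _xor_; if_then_else_)
open import Data.Bool.Properties using (xor-comm)
open import Data.Empty using (⊥; ⊥-elim)
open import Data.Fin using (Fin; zero; suc; punchOut)
open import Data.Fin.Permutation using (Permutation; _⟨$⟩ʳ_; _⟨$⟩ˡ_; inverseˡ; transpose)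
import Data.Fin.Properties as Finₚ
open import Data.List using (List; []; _∷_; _++_; length; map; concatMap; filter; allFin)
open import Data.List.Membership.Propositional using (_∈_)
open import Data.List.Membership.Propositional.Properties using (∈-map⁺; ∈-concatMap⁺; ∈-allFin)
open import Data.List.Properties using (length-tabulate)
open import Data.List.Relation.Unary.Any as Any using (here; there)
open import Data.Nat using (ℕ; zero; suc; _+_; _*_; _^_; _∸_; _≤_; _<_; z≤n; s≤s; NonZero)
open import Data.Nat.Properties
open import Data.Nat.Tactic.RingSolver using (solve-∀)
open import Data.Product using (Σ; _×_; _,_; proj₁; proj₂)
open import Data.Vec using (Vec; []; _∷_; lookup; insertAt; head; tail; toList)
import Data.Vec as Vec
open import Data.Vec.Properties using (insertAt-punchIn; insertAt-lookup; lookup-map; lookup-zipWith; lookup∘tabulate)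
open import Data.Vec.Relation.Unary.All using (All; []; _∷_)
open import Data.Vec.Relation.Unary.AllPairs using (allPairs?)
open import Data.Vec.Relation.Unary.Unique.Propositional using (Unique; []; _∷_)
open import Data.Vec.Relation.Unary.Unique.Propositional.Properties using (tabulate⁺)
open import Function using (_∘_)
open import Function.Definitions using (Injective)
open import Relation.Binary.Definitions using (tri<; tri≈; tri>)
open import Relation.Binary.PropositionalEquality
  using (_≡_; _≢_; refl; cong; cong₂; trans; subst; subst₂; module ≡-Reasoning)
  renaming (sym to ≡-sym)
open import Relation.Nullary using (¬_; Dec; does; yes; no)
open import Relation.Nullary.Decidable using (dec-true; ¬?)

module +-CS = CommSemigroupProperties +-commutativeSemigroup
module *-CS = CommSemigroupProperties *-commutativeSemigroup

private
  variable
    A B C : Set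

∑ : List A → (A → ℕ) → ℕ
∑ []       f = 0
∑ (x ∷ xs) f = f x + ∑ xs f

syntax ∑ xs (λ x → e) = ∑[ x ∈ xs ] e

∑-cong : (xs : List A) {f g : A → ℕ} → (∀ x → f x ≡ g x) → ∑ xs f ≡ ∑ xs g
∑-cong []       f≗g = refl
∑-cong (x ∷ xs) f≗g = cong₂ _+_ (f≗g x) (∑-cong xs f≗g)

∑-mono-≤ : (xs : List A) {f g : A → ℕ} → (∀ x → f x ≤ g x) → ∑ xs f ≤ ∑ xs g
∑-mono-≤ []       f≤g = z≤n
∑-mono-≤ (x ∷ xs) f≤g = +-mono-≤ (f≤g x) (∑-mono-≤ xs f≤g)

∑-++ : (xs ys : List A) (f : A → ℕ) → ∑ (xs ++ ys) f ≡ ∑ xs f + ∑ ys f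
∑-++ []       ys f = refl
∑-++ (x ∷ xs) ys f = trans (cong (f x +_) (∑-++ xs ys f)) (≡-sym (+-assoc (f x) _ _))

∑-+ : (xs : List A) (f g : A → ℕ) → ∑[ x ∈ xs ] (f x + g x) ≡ ∑ xs f + ∑ xs g
∑-+ []       f g = refl
∑-+ (x ∷ xs) f g =
  trans (cong (f x + g x +_) (∑-+ xs f g)) (+-CS.interchange (f x) (g x) _ _)

∑-*ˡ : (xs : List A) (c : ℕ) (f : A → ℕ) → ∑[ x ∈ xs ] (c * f x) ≡ c * ∑ xs f
∑-*ˡ []       c f = ≡-sym (*-zeroʳ c)
∑-*ˡ (x ∷ xs) c f = trans (cong (c * f x +_) (∑-*ˡ xs c f)) (≡-sym (*-distribˡ-+ c (f x) _))

∑-*ʳ : (xs : List A) (c : ℕ) (f : A → ℕ) → ∑[ x ∈ xs ] (f x * c) ≡ ∑ xs f * c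
∑-*ʳ xs c f = trans (∑-cong xs (λ x → *-comm (f x) c)) (trans (∑-*ˡ xs c f) (*-comm c _))

∑-const : (xs : List A) (c : ℕ) → ∑[ _ ∈ xs ] c ≡ length xs * c
∑-const []       c = refl
∑-const (x ∷ xs) c = cong (c +_) (∑-const xs c)

∑-map : (g : A → B) (xs : List A) (f : B → ℕ) → ∑ (map g xs) f ≡ ∑[ x ∈ xs ] f (g x)
∑-map g []       f = refl
∑-map g (x ∷ xs) f = cong (f (g x) +_) (∑-map g xs f)

∑-concatMap : (g : A → List B) (xs : List A) (f : B → ℕ) →
              ∑ (concatMap g xs) f ≡ ∑[ x ∈ xs ] ∑ (g x) f
∑-concatMap g []       f = refl
∑-concatMap g (x ∷ xs) f =
  trans (∑-++ (g x) (concatMap g xs) f) (cong (∑ (g x) f +_) (∑-concatMap g xs f))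

∑-comm : (xs : List A) (ys : List B) (f : A → B → ℕ) →
         ∑[ x ∈ xs ] ∑[ y ∈ ys ] f x y ≡ ∑[ y ∈ ys ] ∑[ x ∈ xs ] f x y
∑-comm []       ys f = ≡-sym (trans (∑-const ys 0) (*-zeroʳ (length ys)))
∑-comm (x ∷ xs) ys f =
  trans (cong (∑ ys (f x) +_) (∑-comm xs ys f)) (≡-sym (∑-+ ys (f x) _))

∑-product : (xs : List A) (ys : List B) (f : A → ℕ) (g : B → ℕ) →
            ∑[ x ∈ xs ] ∑[ y ∈ ys ] (f x * g y) ≡ ∑ xs f * ∑ ys g
∑-product xs ys f g = trans (∑-cong xs λ x → ∑-*ˡ ys (f x) g) (∑-*ʳ xs (∑ ys g) f)

∈⇒≤∑ : {xs : List A} {x : A} (f : A → ℕ) → x ∈ xs → f x ≤ ∑ xs f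
∈⇒≤∑ f (here refl)  = m≤m+n _ _
∈⇒≤∑ f (there x∈xs) = ≤-trans (∈⇒≤∑ f x∈xs) (m≤n+m _ _)

⟦_⟧ : Bool → ℕ
⟦ true  ⟧ = 1
⟦ false ⟧ = 0

⟦∧⟧ : (b c : Bool) → ⟦ b ∧ c ⟧ ≡ ⟦ b ⟧ * ⟦ c ⟧
⟦∧⟧ true  c = ≡-sym (+-identityʳ ⟦ c ⟧)
⟦∧⟧ false c = refl

length-filter≡∑ : (p : A → Bool) (xs : List A) →
                  length (filter (λ x → p x Data.Bool.≟ true) xs) ≡ ∑[ x ∈ xs ] ⟦ p x ⟧
length-filter≡∑ p []       = refl
length-filter≡∑ p (x ∷ xs) with p x
... | true  = cong suc (length-filter≡∑ p xs)
... | false = length-filter≡∑ p xs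

vecs : List A → (k : ℕ) → List (Vec A k)
vecs as zero    = [] ∷ []
vecs as (suc k) = concatMap (λ a → map (a ∷_) (vecs as k)) as

tuples≡vecs : (s n : ℕ) → tuples s n ≡ vecs (allFin n) s
tuples≡vecs zero    n = refl
tuples≡vecs (suc s) n = cong (λ T → concatMap (λ v → map (v ∷_) T) (allFin n)) (tuples≡vecs s n)

∈-vecs : {as : List A} → (∀ a → a ∈ as) → {k : ℕ} (v : Vec A k) → v ∈ vecs as k
∈-vecs all∈ []      = here refl
∈-vecs all∈ (a ∷ v) = ∈-concatMap⁺ _ (Any.map (λ { refl → ∈-map⁺ (a ∷_) (∈-vecs all∈ v) }) (all∈ a))

∑-vecs-suc : (as : List A) (k : ℕ) (f : Vec A (suc k) → ℕ) →
             ∑ (vecs as (suc k)) f ≡ ∑[ a ∈ as ] ∑[ v ∈ vecs as k ] f (a ∷ v)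
∑-vecs-suc as k f = trans (∑-concatMap _ as f) (∑-cong as (λ a → ∑-map (a ∷_) (vecs as k) f))

∑-vecs-const : (as : List A) (k c : ℕ) → ∑[ _ ∈ vecs as k ] c ≡ length as ^ k * c
∑-vecs-const as zero    c = refl
∑-vecs-const as (suc k) c = begin
  ∑[ _ ∈ vecs as (suc k) ] c              ≡⟨ ∑-vecs-suc as k _ ⟩
  ∑[ a ∈ as ] ∑[ _ ∈ vecs as k ] c        ≡⟨ ∑-cong as (λ _ → ∑-vecs-const as k c) ⟩
  ∑[ a ∈ as ] (length as ^ k * c)         ≡⟨ ∑-const as _ ⟩
  length as * (length as ^ k * c)         ≡⟨ *-assoc (length as) _ c ⟨
  length as ^ suc k * c                   ∎
  where open ≡-Reasoning

length-vecs : (as : List A) (k : ℕ) → length (vecs as k) ≡ length as ^ k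
length-vecs as k = begin
  length (vecs as k)          ≡⟨ *-identityʳ _ ⟨
  length (vecs as k) * 1      ≡⟨ ∑-const (vecs as k) 1 ⟨
  ∑[ _ ∈ vecs as k ] 1        ≡⟨ ∑-vecs-const as k 1 ⟩
  length as ^ k * 1           ≡⟨ *-identityʳ _ ⟩
  length as ^ k               ∎
  where open ≡-Reasoning

∑-vecs-allB : (as : List A) (p : A → Bool) (k : ℕ) →
              ∑[ v ∈ vecs as k ] ⟦ allB p (toList v) ⟧ ≡ (∑[ a ∈ as ] ⟦ p a ⟧) ^ k
∑-vecs-allB as p zero    = refl
∑-vecs-allB as p (suc k) = begin
  ∑[ v ∈ vecs as (suc k) ] ⟦ allB p (toList v) ⟧
    ≡⟨ ∑-vecs-suc as k _ ⟩
  ∑[ a ∈ as ] ∑[ v ∈ vecs as k ] ⟦ p a ∧ allB p (toList v) ⟧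
    ≡⟨ ∑-cong as (λ a → ∑-cong (vecs as k) (λ v → ⟦∧⟧ (p a) _)) ⟩
  ∑[ a ∈ as ] ∑[ v ∈ vecs as k ] (⟦ p a ⟧ * ⟦ allB p (toList v) ⟧)
    ≡⟨ ∑-cong as (λ a → ∑-*ˡ (vecs as k) ⟦ p a ⟧ _) ⟩
  ∑[ a ∈ as ] (⟦ p a ⟧ * ∑[ v ∈ vecs as k ] ⟦ allB p (toList v) ⟧)
    ≡⟨ ∑-*ʳ as _ (λ a → ⟦ p a ⟧) ⟩
  ∑[ a ∈ as ] ⟦ p a ⟧ * ∑[ v ∈ vecs as k ] ⟦ allB p (toList v) ⟧
    ≡⟨ cong (∑[ a ∈ as ] ⟦ p a ⟧ *_) (∑-vecs-allB as p k) ⟩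
  (∑[ a ∈ as ] ⟦ p a ⟧) ^ suc k
    ∎
  where open ≡-Reasoning

∑-vecs-insertAt : (as : List A) (n : ℕ) (p : Fin (suc n)) (f : Vec A (suc n) → ℕ) →
                  ∑ (vecs as (suc n)) f ≡ ∑[ a ∈ as ] ∑[ v ∈ vecs as n ] f (insertAt v p a)
∑-vecs-insertAt as n       zero    f = ∑-vecs-suc as n f
∑-vecs-insertAt as (suc n) (suc p) f = begin
  ∑ (vecs as (suc (suc n))) f
    ≡⟨ ∑-vecs-suc as (suc n) f ⟩
  ∑[ b ∈ as ] ∑[ v ∈ vecs as (suc n) ] f (b ∷ v)
    ≡⟨ ∑-cong as (λ b → ∑-vecs-insertAt as n p (λ v → f (b ∷ v))) ⟩
  ∑[ b ∈ as ] ∑[ a ∈ as ] ∑[ v ∈ vecs as n ] f (b ∷ insertAt v p a)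
    ≡⟨ ∑-comm as as _ ⟩
  ∑[ a ∈ as ] ∑[ b ∈ as ] ∑[ v ∈ vecs as n ] f (b ∷ insertAt v p a)
    ≡⟨ ∑-cong as (λ a → ∑-vecs-suc as n (λ w → f (insertAt w (suc p) a))) ⟨
  ∑[ a ∈ as ] ∑[ w ∈ vecs as (suc n) ] f (insertAt w (suc p) a)
    ∎
  where open ≡-Reasoning

∑-vecs-firstColumn : (as : List A) (n s : ℕ) (f : Vec A s → Vec (Vec A n) s → ℕ) →
                 ∑[ R ∈ vecs (vecs as (suc n)) s ] f (Vec.map head R) (Vec.map tail R)
                   ≡ ∑[ c ∈ vecs as s ] ∑[ R ∈ vecs (vecs as n) s ] f c R
∑-vecs-firstColumn as n zero    f = ≡-sym (+-identityʳ _)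
∑-vecs-firstColumn {A} as n (suc s) f = begin
  ∑[ R ∈ vecs rows (suc s) ] f (Vec.map head R) (Vec.map tail R)
    ≡⟨ ∑-vecs-suc rows s _ ⟩
  ∑[ w ∈ vecs as (suc n) ] ∑[ R ∈ vecs rows s ] f (head w ∷ Vec.map head R) (tail w ∷ Vec.map tail R)
    ≡⟨ ∑-vecs-suc as n _ ⟩
  ∑[ a ∈ as ] ∑[ v ∈ vecs as n ] ∑[ R ∈ vecs rows s ] f (a ∷ Vec.map head R) (v ∷ Vec.map tail R)
    ≡⟨ ∑-cong as (λ a → ∑-cong (vecs as n) (λ v → ∑-vecs-firstColumn as n s (λ c R → f (a ∷ c) (v ∷ R)))) ⟩
  ∑[ a ∈ as ] ∑[ v ∈ vecs as n ] ∑[ c ∈ vecs as s ] ∑[ R ∈ vecs rows′ s ] f (a ∷ c) (v ∷ R)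
    ≡⟨ ∑-cong as (λ a → ∑-comm (vecs as n) (vecs as s) _) ⟩
  ∑[ a ∈ as ] ∑[ c ∈ vecs as s ] ∑[ v ∈ vecs as n ] ∑[ R ∈ vecs rows′ s ] f (a ∷ c) (v ∷ R)
    ≡⟨ ∑-cong as (λ a → ∑-cong (vecs as s) (λ c → ∑-vecs-suc rows′ s (f (a ∷ c)))) ⟨
  ∑[ a ∈ as ] ∑[ c ∈ vecs as s ] ∑[ R ∈ vecs rows′ (suc s) ] f (a ∷ c) R
    ≡⟨ ∑-vecs-suc as s _ ⟨
  ∑[ c ∈ vecs as (suc s) ] ∑[ R ∈ vecs rows′ (suc s) ] f c R
    ∎
  where
  open ≡-Reasoning
  rows : List (Vec A (suc n))
  rows = vecs as (suc n)
  rows′ : List (Vec A n)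
  rows′ = vecs as n

-- Every element of ys has exactly c / d preimages in xs under φ (stated without division).
record Equidistributes (φ : A → B) (xs : List A) (ys : List B) (c d : ℕ) : Set where
  field
    ∑-pushforward : ∀ W → d * ∑[ x ∈ xs ] W (φ x) ≡ c * ∑ ys W

open Equidistributes

equidistributes-∘ : {φ : A → B} {ψ : B → C} {xs : List A} {ys : List B} {zs : List C} {c d c′ d′ : ℕ} →
                    Equidistributes φ xs ys c d → Equidistributes ψ ys zs c′ d′ →
                    Equidistributes (ψ ∘ φ) xs zs (c * c′) (d * d′)
equidistributes-∘ {φ = φ} {ψ} {xs} {ys} {zs} {c} {d} {c′} {d′} φ-eq ψ-eq .∑-pushforward W = begin
  d * d′ * ∑[ x ∈ xs ] W (ψ (φ x))    ≡⟨ *-CS.xy∙z≈y∙xz d d′ _ ⟩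
  d′ * (d * ∑[ x ∈ xs ] W (ψ (φ x)))  ≡⟨ cong (d′ *_) (φ-eq .∑-pushforward (W ∘ ψ)) ⟩
  d′ * (c * ∑[ y ∈ ys ] W (ψ y))      ≡⟨ *-CS.x∙yz≈y∙xz d′ c _ ⟩
  c * (d′ * ∑[ y ∈ ys ] W (ψ y))      ≡⟨ cong (c *_) (ψ-eq .∑-pushforward W) ⟩
  c * (c′ * ∑ zs W)                   ≡⟨ *-assoc c c′ _ ⟨
  c * c′ * ∑ zs W                     ∎
  where open ≡-Reasoning

equidistributes-map : {φ : A → B} {xs : List A} {ys : List B} {c d : ℕ} →
                      Equidistributes φ xs ys c d →
                      (s : ℕ) → Equidistributes (Vec.map φ) (vecs xs s) (vecs ys s) (c ^ s) (d ^ s)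
equidistributes-map φ-eq zero    .∑-pushforward W = refl
equidistributes-map {φ = φ} {xs} {ys} {c} {d} φ-eq (suc s) .∑-pushforward W = begin
  d * d ^ s * ∑[ R ∈ vecs xs (suc s) ] W (Vec.map φ R)
    ≡⟨ cong (d * d ^ s *_) (∑-vecs-suc xs s _) ⟩
  d * d ^ s * ∑[ x ∈ xs ] ∑[ R ∈ vecs xs s ] W (φ x ∷ Vec.map φ R)
    ≡⟨ *-assoc d (d ^ s) _ ⟩
  d * (d ^ s * ∑[ x ∈ xs ] ∑[ R ∈ vecs xs s ] W (φ x ∷ Vec.map φ R))
    ≡⟨ cong (d *_) (∑-*ˡ xs (d ^ s) _) ⟨
  d * ∑[ x ∈ xs ] (d ^ s * ∑[ R ∈ vecs xs s ] W (φ x ∷ Vec.map φ R))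
    ≡⟨ cong (d *_) (∑-cong xs (λ x → equidistributes-map φ-eq s .∑-pushforward (W ∘ (φ x ∷_)))) ⟩
  d * ∑[ x ∈ xs ] (c ^ s * ∑[ H ∈ vecs ys s ] W (φ x ∷ H))
    ≡⟨ cong (d *_) (∑-*ˡ xs (c ^ s) _) ⟩
  d * (c ^ s * ∑[ x ∈ xs ] ∑[ H ∈ vecs ys s ] W (φ x ∷ H))
    ≡⟨ *-CS.x∙yz≈y∙xz d (c ^ s) _ ⟩
  c ^ s * (d * ∑[ x ∈ xs ] ∑[ H ∈ vecs ys s ] W (φ x ∷ H))
    ≡⟨ cong (λ z → c ^ s * (d * z)) (∑-comm xs (vecs ys s) _) ⟩
  c ^ s * (d * ∑[ H ∈ vecs ys s ] ∑[ x ∈ xs ] W (φ x ∷ H))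
    ≡⟨ cong (c ^ s *_) (∑-*ˡ (vecs ys s) d _) ⟨
  c ^ s * ∑[ H ∈ vecs ys s ] (d * ∑[ x ∈ xs ] W (φ x ∷ H))
    ≡⟨ cong (c ^ s *_) (∑-cong (vecs ys s) (λ H → φ-eq .∑-pushforward (W ∘ (_∷ H)))) ⟩
  c ^ s * ∑[ H ∈ vecs ys s ] (c * ∑[ y ∈ ys ] W (y ∷ H))
    ≡⟨ cong (c ^ s *_) (∑-*ˡ (vecs ys s) c _) ⟩
  c ^ s * (c * ∑[ H ∈ vecs ys s ] ∑[ y ∈ ys ] W (y ∷ H))
    ≡⟨ cong (λ z → c ^ s * (c * z)) (∑-comm (vecs ys s) ys _) ⟩
  c ^ s * (c * ∑[ y ∈ ys ] ∑[ H ∈ vecs ys s ] W (y ∷ H))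
    ≡⟨ cong (λ z → c ^ s * (c * z)) (∑-vecs-suc ys s W) ⟨
  c ^ s * (c * ∑ (vecs ys (suc s)) W)
    ≡⟨ *-CS.x∙yz≈yx∙z (c ^ s) c _ ⟩
  c * c ^ s * ∑ (vecs ys (suc s)) W
    ∎
  where open ≡-Reasoning

restrict : {r t : ℕ} → Vec (Fin r) t → Vec A r → Vec A t
restrict x g = Vec.map (lookup g) x

punchOutAll : {r t : ℕ} (p : Fin (suc r)) {xs : Vec (Fin (suc r)) t} → All (p ≢_) xs → Vec (Fin r) t
punchOutAll p []           = []
punchOutAll p (p≢q ∷ p∉xs) = punchOut p≢q ∷ punchOutAll p p∉xs

restrict-insertAt : {r t : ℕ} (p : Fin (suc r)) {xs : Vec (Fin (suc r)) t} (p∉xs : All (p ≢_) xs)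
                    (v : Vec A r) (a : A) → restrict xs (insertAt v p a) ≡ restrict (punchOutAll p p∉xs) v
restrict-insertAt p []           v a = refl
restrict-insertAt p {q ∷ _} (p≢q ∷ p∉xs) v a = cong₂ _∷_ lookup-punchOut (restrict-insertAt p p∉xs v a)
  where
  lookup-punchOut : lookup (insertAt v p a) q ≡ lookup v (punchOut p≢q)
  lookup-punchOut = trans (cong (lookup (insertAt v p a)) (≡-sym (Finₚ.punchIn-punchOut p≢q)))
                          (insertAt-punchIn v p a (punchOut p≢q))

punchOutAll-All≢ : {r t : ℕ} {p q : Fin (suc r)} (p≢q : p ≢ q) {xs : Vec (Fin (suc r)) t}
                   (p∉xs : All (p ≢_) xs) → All (q ≢_) xs → All (punchOut p≢q ≢_) (punchOutAll p p∉xs)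
punchOutAll-All≢ p≢q []           []           = []
punchOutAll-All≢ p≢q (p≢s ∷ p∉xs) (q≢s ∷ q∉xs) =
  (q≢s ∘ Finₚ.punchOut-injective p≢q p≢s) ∷ punchOutAll-All≢ p≢q p∉xs q∉xs

punchOutAll-unique : {r t : ℕ} (p : Fin (suc r)) {xs : Vec (Fin (suc r)) t} (p∉xs : All (p ≢_) xs) →
                     Unique xs → Unique (punchOutAll p p∉xs)
punchOutAll-unique p []           []              = []
punchOutAll-unique p (p≢q ∷ p∉xs) (q∉xs ∷ unique) =
  punchOutAll-All≢ p≢q p∉xs q∉xs ∷ punchOutAll-unique p p∉xs unique

-- The r - t coordinates of g outside x are free, so every h has (length as) ^ (r - t) preimages.
restrict-equidistributes : (as : List A) {r t : ℕ} (x : Vec (Fin r) t) → Unique x →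
                           Equidistributes (restrict x) (vecs as r) (vecs as t) (length as ^ r) (length as ^ t)
restrict-equidistributes as {r} [] [] .∑-pushforward W = begin
  1 * ∑[ _ ∈ vecs as r ] W []   ≡⟨ *-identityˡ _ ⟩
  ∑[ _ ∈ vecs as r ] W []       ≡⟨ ∑-vecs-const as r (W []) ⟩
  length as ^ r * W []          ≡⟨ cong (length as ^ r *_) (+-identityʳ (W [])) ⟨
  length as ^ r * (W [] + 0)    ∎
  where open ≡-Reasoning
restrict-equidistributes as {zero}  (() ∷ _) _
restrict-equidistributes as {suc r} {suc t} (p ∷ xs) (p∉xs ∷ unique) .∑-pushforward W = begin
  m * m ^ t * ∑[ g ∈ vecs as (suc r) ] W (restrict (p ∷ xs) g)
    ≡⟨ cong (m * m ^ t *_) (∑-vecs-insertAt as r p _) ⟩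
  m * m ^ t * ∑[ a ∈ as ] ∑[ v ∈ vecs as r ] W (restrict (p ∷ xs) (insertAt v p a))
    ≡⟨ cong (m * m ^ t *_) (∑-cong as λ a → ∑-cong (vecs as r) λ v → cong W (restrict-split a v)) ⟩
  m * m ^ t * ∑[ a ∈ as ] ∑[ v ∈ vecs as r ] W (a ∷ restrict ys v)
    ≡⟨ *-assoc m (m ^ t) _ ⟩
  m * (m ^ t * ∑[ a ∈ as ] ∑[ v ∈ vecs as r ] W (a ∷ restrict ys v))
    ≡⟨ cong (m *_) (∑-*ˡ as (m ^ t) _) ⟨
  m * ∑[ a ∈ as ] (m ^ t * ∑[ v ∈ vecs as r ] W (a ∷ restrict ys v))
    ≡⟨ cong (m *_) (∑-cong as λ a → ys-equidistributes .∑-pushforward (W ∘ (a ∷_))) ⟩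
  m * ∑[ a ∈ as ] (m ^ r * ∑[ h ∈ vecs as t ] W (a ∷ h))
    ≡⟨ cong (m *_) (∑-*ˡ as (m ^ r) _) ⟩
  m * (m ^ r * ∑[ a ∈ as ] ∑[ h ∈ vecs as t ] W (a ∷ h))
    ≡⟨ *-assoc m (m ^ r) _ ⟨
  m * m ^ r * ∑[ a ∈ as ] ∑[ h ∈ vecs as t ] W (a ∷ h)
    ≡⟨ cong (m * m ^ r *_) (∑-vecs-suc as t W) ⟨
  m * m ^ r * ∑ (vecs as (suc t)) W
    ∎
  where
  open ≡-Reasoning
  m : ℕ
  m = length as
  ys : Vec (Fin r) t
  ys = punchOutAll p p∉xs
  ys-equidistributes : Equidistributes (restrict ys) (vecs as r) (vecs as t) (m ^ r) (m ^ t)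
  ys-equidistributes = restrict-equidistributes as ys (punchOutAll-unique p p∉xs unique)
  restrict-split : ∀ a v → restrict (p ∷ xs) (insertAt v p a) ≡ a ∷ restrict ys v
  restrict-split a v = cong₂ _∷_ (insertAt-lookup v p a) (restrict-insertAt p p∉xs v a)

bools : List Bool
bools = true ∷ false ∷ []

∈-bools : (b : Bool) → b ∈ bools
∈-bools true  = here refl
∈-bools false = there (here refl)

_==_ : Bool → Bool → Bool
true  == b = b
false == b = not b

allColour : {n : ℕ} → Bool → Vec Bool n → Vec Bool n → Bool
allColour k row column = allB (k ==_) (toList (Vec.zipWith _xor_ row column))

xorColour : {r : ℕ} → Vec (Vec Bool r) r → Fin r → Fin r → Bool
xorColour G a b = lookup (lookup G a) b xor lookup (lookup G b) a

xorColour-sym : {r : ℕ} (G : Vec (Vec Bool r) r) → ∀ a b → xorColour G a b ≡ xorColour G b a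
xorColour-sym G a b = xor-comm (lookup (lookup G a) b) _

-- Checks that xorColour H gives every pair colour k, peeling off the first row and column.
isMonochromatic : {n : ℕ} → Bool → Vec (Vec Bool n) n → Bool
isMonochromatic {zero}  k []                = true
isMonochromatic {suc n} k ((_ ∷ row) ∷ R) =
  allColour k row (Vec.map head R) ∧ isMonochromatic k (Vec.map tail R)

monochromaticCount : Bool → ℕ → ℕ
monochromaticCount k n = ∑[ H ∈ vecs (vecs bools n) n ] ⟦ isMonochromatic k H ⟧

∑-allColour : (k : Bool) {n : ℕ} (row : Vec Bool n) → ∑[ c ∈ vecs bools n ] ⟦ allColour k row c ⟧ ≡ 1
∑-allColour k []        = refl
∑-allColour k {suc n} (a ∷ row) = begin
  ∑[ c ∈ vecs bools (suc n) ] ⟦ allColour k (a ∷ row) c ⟧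
    ≡⟨ ∑-vecs-suc bools n _ ⟩
  ∑[ b ∈ bools ] ∑[ c ∈ vecs bools n ] ⟦ (k == (a xor b)) ∧ allColour k row c ⟧
    ≡⟨ ∑-cong bools (λ b → ∑-cong (vecs bools n) λ c → ⟦∧⟧ (k == (a xor b)) (allColour k row c)) ⟩
  ∑[ b ∈ bools ] ∑[ c ∈ vecs bools n ] (⟦ k == (a xor b) ⟧ * ⟦ allColour k row c ⟧)
    ≡⟨ ∑-product bools (vecs bools n) (λ b → ⟦ k == (a xor b) ⟧) (λ c → ⟦ allColour k row c ⟧) ⟩
  ∑[ b ∈ bools ] ⟦ k == (a xor b) ⟧ * ∑[ c ∈ vecs bools n ] ⟦ allColour k row c ⟧
    ≡⟨ cong₂ _*_ (unique-completion k a) (∑-allColour k row) ⟩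
  1
    ∎
  where
  open ≡-Reasoning
  unique-completion : ∀ k a → ∑[ b ∈ bools ] ⟦ k == (a xor b) ⟧ ≡ 1
  unique-completion true  true  = refl
  unique-completion true  false = refl
  unique-completion false true  = refl
  unique-completion false false = refl

monochromaticCount-suc : (k : Bool) (n : ℕ) → monochromaticCount k (suc n) ≡ 2 ^ suc n * monochromaticCount k n
monochromaticCount-suc k n = begin
  ∑[ H ∈ vecs rows (suc n) ] ⟦ isMonochromatic k H ⟧
    ≡⟨ ∑-vecs-suc rows n _ ⟩
  ∑[ w ∈ rows ] ∑[ R ∈ vecs rows n ] ⟦ isMonochromatic k (w ∷ R) ⟧
    ≡⟨ ∑-vecs-suc bools n _ ⟩
  ∑[ a ∈ bools ] ∑[ row ∈ vecs bools n ] ∑[ R ∈ vecs rows n ]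
    ⟦ allColour k row (Vec.map head R) ∧ isMonochromatic k (Vec.map tail R) ⟧
    ≡⟨ ∑-cong bools (λ a → ∑-cong (vecs bools n) λ row →
         ∑-vecs-firstColumn bools n n λ c R → ⟦ allColour k row c ∧ isMonochromatic k R ⟧) ⟩
  ∑[ a ∈ bools ] ∑[ row ∈ vecs bools n ] ∑[ c ∈ vecs bools n ] ∑[ R ∈ vecs (vecs bools n) n ]
    ⟦ allColour k row c ∧ isMonochromatic k R ⟧
    ≡⟨ ∑-cong bools (λ a → ∑-cong (vecs bools n) λ row → trans
         (∑-cong (vecs bools n) λ c → ∑-cong (vecs (vecs bools n) n) λ R → ⟦∧⟧ (allColour k row c) _)
         (∑-product (vecs bools n) (vecs (vecs bools n) n)
                    (λ c → ⟦ allColour k row c ⟧) (λ R → ⟦ isMonochromatic k R ⟧))) ⟩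
  ∑[ a ∈ bools ] ∑[ row ∈ vecs bools n ] (∑[ c ∈ vecs bools n ] ⟦ allColour k row c ⟧ * monochromaticCount k n)
    ≡⟨ ∑-cong bools (λ a → ∑-cong (vecs bools n) λ row →
         trans (cong (_* monochromaticCount k n) (∑-allColour k row)) (*-identityˡ _)) ⟩
  ∑[ a ∈ bools ] ∑[ row ∈ vecs bools n ] monochromaticCount k n
    ≡⟨ ∑-cong bools (λ a → ∑-vecs-const bools n (monochromaticCount k n)) ⟩
  ∑[ a ∈ bools ] (2 ^ n * monochromaticCount k n)
    ≡⟨ ∑-const bools (2 ^ n * monochromaticCount k n) ⟩
  2 * (2 ^ n * monochromaticCount k n)
    ≡⟨ *-assoc 2 (2 ^ n) _ ⟨
  2 ^ suc n * monochromaticCount k n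
    ∎
  where
  open ≡-Reasoning
  rows : List (Vec Bool (suc n))
  rows = vecs bools (suc n)

monochromaticCount-colour : (k : Bool) (n : ℕ) → monochromaticCount k n ≡ monochromaticCount true n
monochromaticCount-colour true  n       = refl
monochromaticCount-colour false zero    = refl
monochromaticCount-colour false (suc n) = begin
  monochromaticCount false (suc n)      ≡⟨ monochromaticCount-suc false n ⟩
  2 ^ suc n * monochromaticCount false n ≡⟨ cong (2 ^ suc n *_) (monochromaticCount-colour false n) ⟩
  2 ^ suc n * monochromaticCount true n  ≡⟨ monochromaticCount-suc true n ⟨
  monochromaticCount true (suc n)        ∎
  where open ≡-Reasoning

monochromaticCount-squared : (k : Bool) (n : ℕ) →
                             monochromaticCount k n * monochromaticCount k n ≡ 2 ^ (n * suc n)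
monochromaticCount-squared k zero    = refl
monochromaticCount-squared k (suc n) = begin
  Q (suc n) * Q (suc n)                  ≡⟨ cong₂ _*_ (monochromaticCount-suc k n) (monochromaticCount-suc k n) ⟩
  (2 ^ suc n * Q n) * (2 ^ suc n * Q n)  ≡⟨ *-CS.interchange (2 ^ suc n) (Q n) _ _ ⟩
  (2 ^ suc n * 2 ^ suc n) * (Q n * Q n)
    ≡⟨ cong₂ _*_ (≡-sym (^-distribˡ-+-* 2 (suc n) (suc n))) (monochromaticCount-squared k n) ⟩
  2 ^ (suc n + suc n) * 2 ^ (n * suc n)  ≡⟨ ^-distribˡ-+-* 2 (suc n + suc n) (n * suc n) ⟨
  2 ^ (suc n + suc n + n * suc n)        ≡⟨ cong (2 ^_) (exponent n) ⟩
  2 ^ (suc n * suc (suc n))              ∎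
  where
  open ≡-Reasoning
  Q : ℕ → ℕ
  Q = monochromaticCount k
  exponent : ∀ n → suc n + suc n + n * suc n ≡ suc n * suc (suc n)
  exponent = solve-∀

⟦does⟧+⟦does⟧≤1 : {P Q : Set} → (P → Q → ⊥) → (p : Dec P) (q : Dec Q) → ⟦ does p ⟧ + ⟦ does q ⟧ ≤ 1
⟦does⟧+⟦does⟧≤1 ¬both (yes p) (yes q) = ⊥-elim (¬both p q)
⟦does⟧+⟦does⟧≤1 ¬both (yes _) (no _)  = ≤-refl
⟦does⟧+⟦does⟧≤1 ¬both (no _)  (yes _) = ≤-refl
⟦does⟧+⟦does⟧≤1 ¬both (no _)  (no _)  = z≤n

[_<_] : {r : ℕ} → Fin r → Fin r → ℕ
[ a < b ] = ⟦ does (a Finₚ.<? b) ⟧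

unique? : {r t : ℕ} (x : Vec (Fin r) t) → Dec (Unique x)
unique? = allPairs? (λ a b → ¬? (a Finₚ.≟ b))

ordered : {r t₀ : ℕ} → Vec (Fin r) (2 + t₀) → Bool
ordered (a ∷ b ∷ _) = does (a Finₚ.<? b)

length-allFin : (r : ℕ) → length (allFin r) ≡ r
length-allFin r = length-tabulate (λ i → i)

twice-∑-ordered≤ : {r : ℕ} (as : List (Fin r)) →
                   2 * ∑[ a ∈ as ] ∑[ b ∈ as ] [ a < b ] ≤ length as * length as
twice-∑-ordered≤ as = begin
  2 * S
    ≡⟨ cong (S +_) (+-identityʳ S) ⟩
  S + S
    ≡⟨ cong (S +_) (∑-comm as as _) ⟩
  S + ∑[ a ∈ as ] ∑[ b ∈ as ] [ b < a ]
    ≡⟨ trans (∑-cong as λ a → ∑-+ as _ _) (∑-+ as _ _) ⟨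
  ∑[ a ∈ as ] ∑[ b ∈ as ] ([ a < b ] + [ b < a ])
    ≤⟨ ∑-mono-≤ as (λ a → ∑-mono-≤ as (λ b → at-most-one a b)) ⟩
  ∑[ a ∈ as ] ∑[ b ∈ as ] 1
    ≡⟨ trans (∑-cong as λ a → ∑-const as 1) (∑-const as _) ⟩
  length as * (length as * 1)
    ≡⟨ cong (length as *_) (*-identityʳ _) ⟩
  length as * length as
    ∎
  where
  open ≤-Reasoning
  S : ℕ
  S = ∑[ a ∈ as ] ∑[ b ∈ as ] [ a < b ]
  at-most-one : ∀ a b → [ a < b ] + [ b < a ] ≤ 1
  at-most-one a b = ⟦does⟧+⟦does⟧≤1 Finₚ.<-asym (a Finₚ.<? b) (b Finₚ.<? a)

twice-∑-ordered≤^ : (r t₀ : ℕ) → 2 * ∑[ x ∈ vecs (allFin r) (2 + t₀) ] ⟦ ordered x ⟧ ≤ r ^ (2 + t₀)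
twice-∑-ordered≤^ r t₀ = begin
  2 * ∑[ x ∈ vecs as (2 + t₀) ] ⟦ ordered x ⟧
    ≡⟨ cong (2 *_) (trans (∑-vecs-suc as (suc t₀) _) (∑-cong as λ a → ∑-vecs-suc as t₀ _)) ⟩
  2 * ∑[ a ∈ as ] ∑[ b ∈ as ] ∑[ _ ∈ vecs as t₀ ] [ a < b ]
    ≡⟨ cong (2 *_) (∑-cong as λ a → ∑-cong as λ b → ∑-vecs-const as t₀ _) ⟩
  2 * ∑[ a ∈ as ] ∑[ b ∈ as ] (length as ^ t₀ * [ a < b ])
    ≡⟨ cong (2 *_) (trans (∑-cong as λ a → ∑-*ˡ as (length as ^ t₀) _) (∑-*ˡ as (length as ^ t₀) _)) ⟩
  2 * (length as ^ t₀ * ∑[ a ∈ as ] ∑[ b ∈ as ] [ a < b ])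
    ≡⟨ *-CS.x∙yz≈y∙xz 2 (length as ^ t₀) _ ⟩
  length as ^ t₀ * (2 * ∑[ a ∈ as ] ∑[ b ∈ as ] [ a < b ])
    ≤⟨ *-monoʳ-≤ (length as ^ t₀) (twice-∑-ordered≤ as) ⟩
  length as ^ t₀ * (length as * length as)
    ≡⟨ cong (λ m → m ^ t₀ * (m * m)) (length-allFin r) ⟩
  r ^ t₀ * (r * r)
    ≡⟨ trans (*-comm (r ^ t₀) (r * r)) (*-assoc r r (r ^ t₀)) ⟩
  r ^ (2 + t₀)
    ∎
  where
  open ≤-Reasoning
  as : List (Fin r)
  as = allFin r

∧-intro : {a b : Bool} → a ≡ true → b ≡ true → a ∧ b ≡ true
∧-intro refl refl = refl

allB-intro : {t : ℕ} (p : A → Bool) (vs : Vec A t) → (∀ i → p (lookup vs i) ≡ true) → allB p (toList vs) ≡ true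
allB-intro p []       all-p = refl
allB-intro p (v ∷ vs) all-p = ∧-intro (all-p zero) (allB-intro p vs (all-p ∘ suc))

==-reflexive : {b k : Bool} → b ≡ k → (k == b) ≡ true
==-reflexive {true}  refl = refl
==-reflexive {false} refl = refl

allColour-intro : {n : ℕ} (k : Bool) (row column : Vec Bool n) →
                  (∀ j → lookup row j xor lookup column j ≡ k) → allColour k row column ≡ true
allColour-intro k row column colour-k = allB-intro (k ==_) (Vec.zipWith _xor_ row column)
  λ j → ==-reflexive (trans (lookup-zipWith _xor_ j row column) (colour-k j))

lookup-map-head : {m n : ℕ} (R : Vec (Vec A (suc n)) m) (j : Fin m) →
                  lookup (Vec.map head R) j ≡ lookup (lookup R j) zero
lookup-map-head ((_ ∷ _) ∷ _) zero    = refl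
lookup-map-head (_ ∷ R)       (suc j) = lookup-map-head R j

lookup-map-tail : {m n : ℕ} (R : Vec (Vec A (suc n)) m) (i : Fin m) (j : Fin n) →
                  lookup (lookup (Vec.map tail R) i) j ≡ lookup (lookup R i) (suc j)
lookup-map-tail ((_ ∷ _) ∷ _) zero    j = refl
lookup-map-tail (_ ∷ R)       (suc i) j = lookup-map-tail R i j

isMonochromatic-intro : {n : ℕ} (k : Bool) (H : Vec (Vec Bool n) n) →
                        (∀ i j → i ≢ j → xorColour H i j ≡ k) → isMonochromatic k H ≡ true
isMonochromatic-intro {zero}  k []              mono = refl
isMonochromatic-intro {suc n} k ((a ∷ row) ∷ R) mono = ∧-intro first-row other-rows
  where
  first-row : allColour k row (Vec.map head R) ≡ true
  first-row = allColour-intro k row (Vec.map head R) λ j →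
    trans (cong (lookup row j xor_) (lookup-map-head R j)) (mono zero (suc j) λ ())
  other-rows : isMonochromatic k (Vec.map tail R) ≡ true
  other-rows = isMonochromatic-intro k (Vec.map tail R) λ i j i≢j →
    trans (cong₂ _xor_ (lookup-map-tail R i j) (lookup-map-tail R j i)) (mono (suc i) (suc j) (i≢j ∘ Finₚ.suc-injective))

MonochromaticOn : {r t : ℕ} → (Fin r → Fin r → C) → Vec (Fin r) t → C → Set
MonochromaticOn c x k = ∀ i j → i ≢ j → c (lookup x i) (lookup x j) ≡ k

restrict-monochromatic : {r t : ℕ} (G : Vec (Vec Bool r) r) (x : Vec (Fin r) t) {k : Bool} →
                         MonochromaticOn (xorColour G) x k → isMonochromatic k (Vec.map (restrict x) (restrict x G)) ≡ true
restrict-monochromatic G x {k} mono = isMonochromatic-intro k _ λ i j i≢j →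
  trans (cong₂ _xor_ (entry i j) (entry j i)) (mono i j i≢j)
  where
  entry : ∀ i j → lookup (lookup (Vec.map (restrict x) (restrict x G)) i) j ≡ lookup (lookup G (lookup x i)) (lookup x j)
  entry i j rewrite lookup-map i (restrict x) (restrict x G) | lookup-map i (lookup G) x
                  | lookup-map j (lookup (lookup G (lookup x i))) x = refl

bitColour : Bool → Fin 2
bitColour b = if b then suc zero else zero

bitColour-injective : (b c : Bool) → bitColour b ≡ bitColour c → b ≡ c
bitColour-injective true  true  _ = refl
bitColour-injective false false _ = refl

if-zero : {n : ℕ} (b : Bool) {c : Fin n} → (if b then zero else suc c) ≡ zero → b ≡ true
if-zero true refl = refl

if-suc : {n : ℕ} (b : Bool) {c k : Fin n} → (if b then zero else suc c) ≡ suc k → b ≡ false × c ≡ k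
if-suc false refl = refl , refl

module _ {N : ℕ} (Gr : Graph N) where

  pairwiseAdjacent⇒clique : {t : ℕ} (f : Fin t → Fin N) →
                            (∀ i j → i ≢ j → adj Gr (f i) (f j) ≡ true) → HasClique Gr t
  pairwiseAdjacent⇒clique f adjacent = f , injective , adjacent
    where
    injective : ∀ {i j} → f i ≡ f j → i ≡ j
    injective {i} {j} fi≡fj with i Finₚ.≟ j
    ... | yes i≡j = i≡j
    ... | no  i≢j with () ← trans (≡-sym (adjacent i j i≢j))
                                  (trans (cong (λ v → adj Gr v (f j)) fi≡fj) (irrefl Gr (f j)))

  pairwiseNonadjacent⇒independent : {t : ℕ} (vs : Vec (Fin N) t) →
                                    (∀ i j → i ≢ j → adj Gr (lookup vs i) (lookup vs j) ≡ false) →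
                                    isIndependent Gr vs ≡ true
  pairwiseNonadjacent⇒independent vs nonadjacent =
    allB-intro _ vs λ i → allB-intro _ vs λ j → cong not (nonadjacent′ i j)
    where
    nonadjacent′ : ∀ i j → adj Gr (lookup vs i) (lookup vs j) ≡ false
    nonadjacent′ i j with i Finₚ.≟ j
    ... | yes refl = irrefl Gr (lookup vs i)
    ... | no  i≢j  = nonadjacent i j i≢j

  layeredColour : {r L : ℕ} → Vec (Vec (Fin N) r) L → (Fin r → Fin r → Bool) → Fin r → Fin r → Fin (2 + L)
  layeredColour []      β a b = bitColour (β a b)
  layeredColour (f ∷ F) β a b = if adj Gr (lookup f a) (lookup f b) then zero else suc (layeredColour F β a b)

  layeredColour-sym : {r L : ℕ} (F : Vec (Vec (Fin N) r) L) {β : Fin r → Fin r → Bool} →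
                      (∀ a b → β a b ≡ β b a) → ∀ a b → layeredColour F β a b ≡ layeredColour F β b a
  layeredColour-sym []      β-sym a b = cong bitColour (β-sym a b)
  layeredColour-sym (f ∷ F) β-sym a b =
    cong₂ (λ e c → if e then zero else suc c) (Graph.sym Gr (lookup f a) (lookup f b)) (layeredColour-sym F β-sym a b)

  monochromatic-layeredColour : {r t L : ℕ} → ¬ HasClique Gr t →
                                (x : Vec (Fin r) t) (F : Vec (Vec (Fin N) r) L)
                                {β : Fin r → Fin r → Bool} {k : Fin (2 + L)} →
                                MonochromaticOn (layeredColour F β) x k →
                                allB (isIndependent Gr) (toList (Vec.map (restrict x) F)) ≡ true
                                × Σ Bool (MonochromaticOn β x)
  monochromatic-layeredColour no-clique x [] {k = zero} mono =
    refl , false , λ i j i≢j → bitColour-injective _ false (mono i j i≢j)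
  monochromatic-layeredColour no-clique x [] {k = suc zero} mono =
    refl , true , λ i j i≢j → bitColour-injective _ true (mono i j i≢j)
  monochromatic-layeredColour no-clique x (f ∷ F) {k = zero} mono =
    ⊥-elim (no-clique (pairwiseAdjacent⇒clique (lookup f ∘ lookup x) λ i j i≢j → if-zero _ (mono i j i≢j)))
  monochromatic-layeredColour no-clique x (f ∷ F) {k = suc k} mono
    with independent , β-mono ← monochromatic-layeredColour no-clique x F (λ i j i≢j → proj₂ (if-suc _ (mono i j i≢j)))
    = ∧-intro (pairwiseNonadjacent⇒independent (restrict x f) nonadjacent) independent , β-mono
    where
    nonadjacent : ∀ i j → i ≢ j → adj Gr (lookup (restrict x f) i) (lookup (restrict x f) j) ≡ false
    nonadjacent i j i≢j rewrite lookup-map i (lookup f) x | lookup-map j (lookup f) x = proj₁ (if-suc _ (mono i j i≢j))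

module _ {r : ℕ} (c : Fin r → Fin r → C) {k : C} where

  permute-monochromatic : {t : ℕ} (π : Permutation t t) {f : Fin t → Fin r} →
                          Injective _≡_ _≡_ f → (∀ i j → i ≢ j → c (f i) (f j) ≡ k) →
                          Injective _≡_ _≡_ (f ∘ (π ⟨$⟩ʳ_))
                          × (∀ i j → i ≢ j → c (f (π ⟨$⟩ʳ i)) (f (π ⟨$⟩ʳ j)) ≡ k)
  permute-monochromatic π f-inj mono = π-inj ∘ f-inj , λ i j i≢j → mono _ _ (i≢j ∘ π-inj)
    where
    π-inj : Injective _≡_ _≡_ (π ⟨$⟩ʳ_)
    π-inj e = trans (≡-sym (inverseˡ π)) (trans (cong (π ⟨$⟩ˡ_) e) (inverseˡ π))

  tabulate-monochromatic : {t : ℕ} {f : Fin t → Fin r} →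
                           Injective _≡_ _≡_ f → (∀ i j → i ≢ j → c (f i) (f j) ≡ k) →
                           Unique (Vec.tabulate f) × MonochromaticOn c (Vec.tabulate f) k
  tabulate-monochromatic {f = f} f-inj mono = tabulate⁺ f-inj , λ i j i≢j →
    subst₂ (λ a b → c a b ≡ k) (≡-sym (lookup∘tabulate f i)) (≡-sym (lookup∘tabulate f j)) (mono i j i≢j)

-- Precomposing with a transposition if necessary gives x₀ < x₁; this is the source of the factor 1/2.
orderedMonochromaticClique : {t₀ ℓ r : ℕ} → RamseyProperty (2 + t₀) ℓ r →
                             (c : Fin r → Fin r → Fin ℓ) → (∀ i j → c i j ≡ c j i) →
                             Σ (Vec (Fin r) (2 + t₀)) λ x →
                               Unique x × ordered x ≡ true × Σ (Fin ℓ) (MonochromaticOn c x)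
orderedMonochromaticClique ram c c-sym with ram c c-sym
... | f , f-inj , k , mono with Finₚ.<-cmp (f zero) (f (suc zero))
...   | tri< f₀<f₁ _ _ =
  let unique , mono′ = tabulate-monochromatic c f-inj mono
  in Vec.tabulate f , unique , dec-true (f zero Finₚ.<? f (suc zero)) f₀<f₁ , k , mono′
...   | tri≈ _ f₀≡f₁ _ with () ← f-inj f₀≡f₁
...   | tri> _ _ f₁<f₀ =
  let π = transpose zero (suc zero)
      f′-inj , f′-mono = permute-monochromatic c π f-inj mono
      unique , mono′ = tabulate-monochromatic c f′-inj f′-mono
  in Vec.tabulate (f ∘ (π ⟨$⟩ʳ_)) , unique , dec-true (f (suc zero) Finₚ.<? f zero) f₁<f₀ , k , mono′

module DoubleCounting {n : ℕ} (Gr : Graph (suc n)) (r t₀ L : ℕ) where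

  private
    N t : ℕ
    N = suc n
    t = 2 + t₀

  Layers Bits : Set
  Layers = Vec (Vec (Fin N) r) L
  Bits   = Vec (Vec Bool r) r

  allLayers : List Layers
  allLayers = vecs (vecs (allFin N) r) L

  allBits : List Bits
  allBits = vecs (vecs bools r) r

  allIndependent : {m : ℕ} → Vec (Vec (Fin N) t) m → Bool
  allIndependent H = allB (isIndependent Gr) (toList H)

  isBad : Vec (Fin r) t → Bool → Layers → Bits → Bool
  isBad x kb F G = (does (unique? x) ∧ ordered x)
                 ∧ (allIndependent (Vec.map (restrict x) F) ∧ isMonochromatic kb (Vec.map (restrict x) (restrict x G)))

  some-isBad : ¬ HasClique Gr t → RamseyProperty t (2 + L) r →
               ∀ F G → 1 ≤ ∑[ x ∈ vecs (allFin r) t ] ∑[ kb ∈ bools ] ⟦ isBad x kb F G ⟧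
  some-isBad no-clique ramsey F G =
    let x , unique , x-ordered , k , mono = orderedMonochromaticClique ramsey (layeredColour Gr F (xorColour G))
                                              (layeredColour-sym Gr F (xorColour-sym G))
        independent , kb , bits-mono = monochromatic-layeredColour Gr no-clique x F mono
        x-isBad : isBad x kb F G ≡ true
        x-isBad = ∧-intro (∧-intro (dec-true (unique? x) unique) x-ordered)
                          (∧-intro independent (restrict-monochromatic G x bits-mono))
    in begin
      1
        ≡⟨ cong ⟦_⟧ x-isBad ⟨
      ⟦ isBad x kb F G ⟧
        ≤⟨ ∈⇒≤∑ (λ kb → ⟦ isBad x kb F G ⟧) (∈-bools kb) ⟩
      ∑[ kb ∈ bools ] ⟦ isBad x kb F G ⟧
        ≤⟨ ∈⇒≤∑ (λ x → ∑[ kb ∈ bools ] ⟦ isBad x kb F G ⟧) (∈-vecs ∈-allFin x) ⟩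
      ∑[ x ∈ vecs (allFin r) t ] ∑[ kb ∈ bools ] ⟦ isBad x kb F G ⟧
        ∎
    where open ≤-Reasoning

  independentCount : ℕ
  independentCount = ∑[ h ∈ vecs (allFin N) t ] ⟦ isIndependent Gr h ⟧

  layerCount : Vec (Fin r) t → ℕ
  layerCount x = ∑[ F ∈ allLayers ] ⟦ allIndependent (Vec.map (restrict x) F) ⟧

  bitCount : Vec (Fin r) t → Bool → ℕ
  bitCount x kb = ∑[ G ∈ allBits ] ⟦ isMonochromatic kb (Vec.map (restrict x) (restrict x G)) ⟧

  layerCount-unique : (x : Vec (Fin r) t) → Unique x → (N ^ t) ^ L * layerCount x ≡ (N ^ r) ^ L * independentCount ^ L
  layerCount-unique x unique = begin
    (N ^ t) ^ L * layerCount x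
      ≡⟨ cong (λ m → (m ^ t) ^ L * layerCount x) (length-allFin N) ⟨
    (length vs ^ t) ^ L * layerCount x
      ≡⟨ equidistributes-map (restrict-equidistributes vs x unique) L .∑-pushforward (λ H → ⟦ allIndependent H ⟧) ⟩
    (length vs ^ r) ^ L * ∑[ H ∈ vecs (vecs vs t) L ] ⟦ allIndependent H ⟧
      ≡⟨ cong₂ _*_ (cong (λ m → (m ^ r) ^ L) (length-allFin N)) (∑-vecs-allB (vecs vs t) (isIndependent Gr) L) ⟩
    (N ^ r) ^ L * independentCount ^ L
      ∎
    where
    open ≡-Reasoning
    vs : List (Fin N)
    vs = allFin N

  bitCount-unique : (x : Vec (Fin r) t) → Unique x → (kb : Bool) →
                    (2 ^ t) ^ t * bitCount x kb ≡ (2 ^ r) ^ r * monochromaticCount kb t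
  bitCount-unique x unique kb = *-cancelˡ-≡ _ _ ((2 ^ r) ^ t) {{m^n≢0 (2 ^ r) t {{m^n≢0 2 r}}}} (begin
    (2 ^ r) ^ t * ((2 ^ t) ^ t * bitCount x kb)
      ≡⟨ *-assoc ((2 ^ r) ^ t) _ _ ⟨
    (2 ^ r) ^ t * (2 ^ t) ^ t * bitCount x kb
      ≡⟨ cong (λ m → m ^ t * (2 ^ t) ^ t * bitCount x kb) (length-vecs bools r) ⟨
    length rows ^ t * (2 ^ t) ^ t * bitCount x kb
      ≡⟨ restrict²-equidistributes .∑-pushforward (λ H → ⟦ isMonochromatic kb H ⟧) ⟩
    length rows ^ r * (2 ^ r) ^ t * monochromaticCount kb t
      ≡⟨ cong (λ m → m ^ r * (2 ^ r) ^ t * monochromaticCount kb t) (length-vecs bools r) ⟩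
    (2 ^ r) ^ r * (2 ^ r) ^ t * monochromaticCount kb t
      ≡⟨ *-CS.xy∙z≈y∙xz ((2 ^ r) ^ r) ((2 ^ r) ^ t) _ ⟩
    (2 ^ r) ^ t * ((2 ^ r) ^ r * monochromaticCount kb t)
      ∎)
    where
    open ≡-Reasoning
    rows : List (Vec Bool r)
    rows = vecs bools r
    restrict²-equidistributes : Equidistributes (Vec.map (restrict x) ∘ restrict x) allBits (vecs (vecs bools t) t)
                                                (length rows ^ r * (2 ^ r) ^ t) (length rows ^ t * (2 ^ t) ^ t)
    restrict²-equidistributes = equidistributes-∘ (restrict-equidistributes rows x unique)
                                                  (equidistributes-map (restrict-equidistributes bools x unique) t)

  badCount : Vec (Fin r) t → Bool → ℕ
  badCount x kb = ∑[ F ∈ allLayers ] ∑[ G ∈ allBits ] ⟦ isBad x kb F G ⟧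

  badCount≡ : (x : Vec (Fin r) t) (kb : Bool) →
              badCount x kb ≡ ⟦ does (unique? x) ∧ ordered x ⟧ * (layerCount x * bitCount x kb)
  badCount≡ x kb = begin
    badCount x kb
      ≡⟨ ∑-cong allLayers (λ F → ∑-cong allBits λ G →
           trans (⟦∧⟧ o _) (cong (⟦ o ⟧ *_) (⟦∧⟧ (layersOk F) (bitsOk G)))) ⟩
    ∑[ F ∈ allLayers ] ∑[ G ∈ allBits ] (⟦ o ⟧ * (⟦ layersOk F ⟧ * ⟦ bitsOk G ⟧))
      ≡⟨ ∑-cong allLayers (λ F → ∑-*ˡ allBits ⟦ o ⟧ _) ⟩
    ∑[ F ∈ allLayers ] (⟦ o ⟧ * ∑[ G ∈ allBits ] (⟦ layersOk F ⟧ * ⟦ bitsOk G ⟧))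
      ≡⟨ ∑-*ˡ allLayers ⟦ o ⟧ _ ⟩
    ⟦ o ⟧ * ∑[ F ∈ allLayers ] ∑[ G ∈ allBits ] (⟦ layersOk F ⟧ * ⟦ bitsOk G ⟧)
      ≡⟨ cong (⟦ o ⟧ *_) (∑-product allLayers allBits (λ F → ⟦ layersOk F ⟧) (λ G → ⟦ bitsOk G ⟧)) ⟩
    ⟦ o ⟧ * (layerCount x * bitCount x kb)
      ∎
    where
    open ≡-Reasoning
    o : Bool
    o = does (unique? x) ∧ ordered x
    layersOk : Layers → Bool
    layersOk F = allIndependent (Vec.map (restrict x) F)
    bitsOk : Bits → Bool
    bitsOk G = isMonochromatic kb (Vec.map (restrict x) (restrict x G))

  private
    P M Q : ℕ
    P = (N ^ t) ^ L * (2 ^ t) ^ t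
    M = (N ^ r) ^ L * (2 ^ r) ^ r
    Q = monochromaticCount true t

  badCount-bound : (x : Vec (Fin r) t) (kb : Bool) → P * badCount x kb ≤ ⟦ ordered x ⟧ * (M * (independentCount ^ L * Q))
  badCount-bound x kb rewrite badCount≡ x kb with unique? x
  ... | no _       = ≤-trans (≤-reflexive (*-zeroʳ P)) z≤n
  ... | yes unique = ≤-reflexive (begin
    P * (⟦ ordered x ⟧ * (layerCount x * bitCount x kb))
      ≡⟨ *-CS.x∙yz≈y∙xz P ⟦ ordered x ⟧ _ ⟩
    ⟦ ordered x ⟧ * (P * (layerCount x * bitCount x kb))
      ≡⟨ cong (⟦ ordered x ⟧ *_) (*-CS.interchange ((N ^ t) ^ L) ((2 ^ t) ^ t) _ _) ⟩
    ⟦ ordered x ⟧ * ((N ^ t) ^ L * layerCount x * ((2 ^ t) ^ t * bitCount x kb))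
      ≡⟨ cong (⟦ ordered x ⟧ *_) (cong₂ _*_ (layerCount-unique x unique)
            (trans (bitCount-unique x unique kb) (cong ((2 ^ r) ^ r *_) (monochromaticCount-colour kb t)))) ⟩
    ⟦ ordered x ⟧ * ((N ^ r) ^ L * independentCount ^ L * ((2 ^ r) ^ r * Q))
      ≡⟨ cong (⟦ ordered x ⟧ *_) (*-CS.interchange ((N ^ r) ^ L) _ _ _) ⟩
    ⟦ ordered x ⟧ * (M * (independentCount ^ L * Q))
      ∎)
    where open ≡-Reasoning

  allLayers×allBits : ∑[ F ∈ allLayers ] ∑[ G ∈ allBits ] 1 ≡ M
  allLayers×allBits = begin
    ∑[ F ∈ allLayers ] ∑[ G ∈ allBits ] 1
      ≡⟨ ∑-cong allLayers (λ F → ∑-vecs-const (vecs bools r) r 1) ⟩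
    ∑[ F ∈ allLayers ] (length rows ^ r * 1)
      ≡⟨ ∑-vecs-const (vecs (allFin N) r) L _ ⟩
    length vss ^ L * (length rows ^ r * 1)
      ≡⟨ cong₂ (λ a b → a ^ L * (b ^ r * 1)) (length-vecs (allFin N) r) (length-vecs bools r) ⟩
    (length (allFin N) ^ r) ^ L * ((2 ^ r) ^ r * 1)
      ≡⟨ cong₂ (λ a b → (a ^ r) ^ L * b) (length-allFin N) (*-identityʳ _) ⟩
    M
      ∎
    where
    open ≡-Reasoning
    rows : List (Vec Bool r)
    rows = vecs bools r
    vss : List (Vec (Fin N) r)
    vss = vecs (allFin N) r

  private
    X : List (Vec (Fin r) t)
    X = vecs (allFin r) t

  M≤∑badCount : ¬ HasClique Gr t → RamseyProperty t (2 + L) r → M ≤ ∑[ x ∈ X ] ∑[ kb ∈ bools ] badCount x kb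
  M≤∑badCount no-clique ramsey = begin
    M
      ≡⟨ allLayers×allBits ⟨
    ∑[ F ∈ allLayers ] ∑[ G ∈ allBits ] 1
      ≤⟨ ∑-mono-≤ allLayers (λ F → ∑-mono-≤ allBits λ G → some-isBad no-clique ramsey F G) ⟩
    ∑[ F ∈ allLayers ] ∑[ G ∈ allBits ] ∑[ x ∈ X ] ∑[ kb ∈ bools ] ⟦ isBad x kb F G ⟧
      ≡⟨ ∑-cong allLayers (λ F → ∑-comm allBits X _) ⟩
    ∑[ F ∈ allLayers ] ∑[ x ∈ X ] ∑[ G ∈ allBits ] ∑[ kb ∈ bools ] ⟦ isBad x kb F G ⟧
      ≡⟨ ∑-comm allLayers X _ ⟩
    ∑[ x ∈ X ] ∑[ F ∈ allLayers ] ∑[ G ∈ allBits ] ∑[ kb ∈ bools ] ⟦ isBad x kb F G ⟧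
      ≡⟨ ∑-cong X (λ x → ∑-cong allLayers λ F → ∑-comm allBits bools (λ G kb → ⟦ isBad x kb F G ⟧)) ⟩
    ∑[ x ∈ X ] ∑[ F ∈ allLayers ] ∑[ kb ∈ bools ] ∑[ G ∈ allBits ] ⟦ isBad x kb F G ⟧
      ≡⟨ ∑-cong X (λ x → ∑-comm allLayers bools (λ F kb → ∑[ G ∈ allBits ] ⟦ isBad x kb F G ⟧)) ⟩
    ∑[ x ∈ X ] ∑[ kb ∈ bools ] badCount x kb
      ∎
    where open ≤-Reasoning

  P*∑badCount≤ : P * ∑[ x ∈ X ] ∑[ kb ∈ bools ] badCount x kb ≤ M * (r ^ t * (independentCount ^ L * Q))
  P*∑badCount≤ = begin
    P * ∑[ x ∈ X ] ∑[ kb ∈ bools ] badCount x kb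
      ≡⟨ trans (∑-cong X λ x → ∑-*ˡ bools P (badCount x)) (∑-*ˡ X P λ x → ∑[ kb ∈ bools ] badCount x kb) ⟨
    ∑[ x ∈ X ] ∑[ kb ∈ bools ] (P * badCount x kb)
      ≤⟨ ∑-mono-≤ X (λ x → ∑-mono-≤ bools λ kb → badCount-bound x kb) ⟩
    ∑[ x ∈ X ] ∑[ kb ∈ bools ] (⟦ ordered x ⟧ * MJ)
      ≡⟨ ∑-cong X (λ x → ∑-const bools (⟦ ordered x ⟧ * MJ)) ⟩
    ∑[ x ∈ X ] (2 * (⟦ ordered x ⟧ * MJ))
      ≡⟨ trans (∑-cong X λ x → ≡-sym (*-assoc 2 ⟦ ordered x ⟧ MJ))
               (trans (∑-*ʳ X MJ _) (cong (_* MJ) (∑-*ˡ X 2 _))) ⟩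
    2 * ∑[ x ∈ X ] ⟦ ordered x ⟧ * MJ
      ≤⟨ *-monoˡ-≤ MJ (twice-∑-ordered≤^ r t₀) ⟩
    r ^ t * MJ
      ≡⟨ *-CS.x∙yz≈y∙xz (r ^ t) M _ ⟩
    M * (r ^ t * (independentCount ^ L * Q))
      ∎
    where
    open ≤-Reasoning
    MJ : ℕ
    MJ = M * (independentCount ^ L * Q)

  ramsey-bound : ¬ HasClique Gr t → RamseyProperty t (2 + L) r → P ≤ r ^ t * (independentCount ^ L * Q)
  ramsey-bound no-clique ramsey = *-cancelˡ-≤ M {{M≢0}} (begin
    M * P                                         ≤⟨ *-monoˡ-≤ P (M≤∑badCount no-clique ramsey) ⟩
    ∑[ x ∈ X ] ∑[ kb ∈ bools ] badCount x kb * P  ≡⟨ *-comm _ P ⟩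
    P * ∑[ x ∈ X ] ∑[ kb ∈ bools ] badCount x kb  ≤⟨ P*∑badCount≤ ⟩
    M * (r ^ t * (independentCount ^ L * Q))      ∎)
    where
    open ≤-Reasoning
    M≢0 : NonZero M
    M≢0 = m*n≢0 _ _ {{m^n≢0 (N ^ r) L {{m^n≢0 N r}}}} {{m^n≢0 (2 ^ r) r {{m^n≢0 2 r}}}}

  independentCount≡indepCount : independentCount ≡ indepCount t Gr
  independentCount≡indepCount = ≡-sym (begin
    indepCount t Gr
      ≡⟨ cong (λ T → length (filter (λ v → isIndependent Gr v Data.Bool.≟ true) T)) (tuples≡vecs t N) ⟩
    length (filter (λ v → isIndependent Gr v Data.Bool.≟ true) (vecs (allFin N) t))
      ≡⟨ length-filter≡∑ (isIndependent Gr) (vecs (allFin N) t) ⟩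
    independentCount
      ∎)
    where open ≡-Reasoning

^-double : (x n : ℕ) → x ^ n * x ^ n ≡ x ^ (2 * n)
^-double x n = trans (≡-sym (^-distribˡ-+-* x n n)) (cong (x ^_) (cong (n +_) (≡-sym (+-identityʳ n))))

-- Squaring clears the half-integral exponent hidden in Q, since Q * Q = 2 ^ (t (t + 1)).
square-bound : (N r I L u Q : ℕ) → Q * Q ≡ 2 ^ (suc u * suc (suc u)) →
               (N ^ suc u) ^ L * (2 ^ suc u) ^ suc u ≤ r ^ suc u * (I ^ L * Q) →
               2 ^ (suc u * u) * N ^ (2 * suc u * L) ≤ r ^ (2 * suc u) * I ^ (2 * L)
square-bound N r I L u Q Q²≡ bound = *-cancelˡ-≤ (2 ^ (t * suc t)) {{m^n≢0 2 (t * suc t)}} (begin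
  2 ^ (t * suc t) * (2 ^ (t * u) * N ^ (2 * t * L))
    ≡⟨ *-CS.x∙yz≈y∙zx (N ^ (2 * t * L)) (2 ^ (t * suc t)) _ ⟨
  N ^ (2 * t * L) * (2 ^ (t * suc t) * 2 ^ (t * u))
    ≡⟨ cong₂ _*_ N-part 2-part ⟨
  (a * a) * (b * b)
    ≡⟨ *-CS.interchange a b a b ⟨
  (a * b) * (a * b)
    ≤⟨ *-mono-≤ bound bound ⟩
  (r ^ t * (I ^ L * Q)) * (r ^ t * (I ^ L * Q))
    ≡⟨ *-CS.interchange (r ^ t) _ (r ^ t) _ ⟩
  (r ^ t * r ^ t) * ((I ^ L * Q) * (I ^ L * Q))
    ≡⟨ cong ((r ^ t * r ^ t) *_) (*-CS.interchange (I ^ L) Q (I ^ L) Q) ⟩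
  (r ^ t * r ^ t) * ((I ^ L * I ^ L) * (Q * Q))
    ≡⟨ cong₂ (λ x y → x * (y * (Q * Q))) (^-double r t) (^-double I L) ⟩
  r ^ (2 * t) * (I ^ (2 * L) * (Q * Q))
    ≡⟨ cong (λ q → r ^ (2 * t) * (I ^ (2 * L) * q)) Q²≡ ⟩
  r ^ (2 * t) * (I ^ (2 * L) * 2 ^ (t * suc t))
    ≡⟨ *-CS.x∙yz≈z∙xy (r ^ (2 * t)) (I ^ (2 * L)) (2 ^ (t * suc t)) ⟩
  2 ^ (t * suc t) * (r ^ (2 * t) * I ^ (2 * L))
    ∎)
  where
  open ≤-Reasoning
  t a b : ℕ
  t = suc u
  a = (N ^ t) ^ L
  b = (2 ^ t) ^ t
  N-part : a * a ≡ N ^ (2 * t * L)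
  N-part = begin-equality
    a * a                ≡⟨ ^-double (N ^ t) L ⟩
    (N ^ t) ^ (2 * L)    ≡⟨ ^-*-assoc N t (2 * L) ⟩
    N ^ (t * (2 * L))    ≡⟨ cong (N ^_) (*-CS.x∙yz≈y∙xz t 2 L) ⟩
    N ^ (2 * (t * L))    ≡⟨ cong (N ^_) (*-assoc 2 t L) ⟨
    N ^ (2 * t * L)      ∎
  2-part : b * b ≡ 2 ^ (t * suc t) * 2 ^ (t * u)
  2-part = begin-equality
    b * b                        ≡⟨ ^-double (2 ^ t) t ⟩
    (2 ^ t) ^ (2 * t)            ≡⟨ ^-*-assoc 2 t (2 * t) ⟩
    2 ^ (t * (2 * t))            ≡⟨ cong (2 ^_) (exponent u) ⟩
    2 ^ (t * suc t + t * u)      ≡⟨ ^-distribˡ-+-* 2 (t * suc t) (t * u) ⟩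
    2 ^ (t * suc t) * 2 ^ (t * u) ∎
    where
    exponent : ∀ u → suc u * (2 * suc u) ≡ suc u * suc (suc u) + suc u * u
    exponent = solve-∀

mainTheorem2 : (ℓ t : ℕ) → 2 < ℓ → 2 < t →
    (r : ℕ) → IsRamseyNumber t ℓ r →
    (n : ℕ) → (G : Graph (suc n)) → ¬ HasClique G t →
    2 ^ (t * (t ∸ 1)) * suc n ^ (2 * t * (ℓ ∸ 2))
      ≤ r ^ (2 * t) * indepCount t G ^ (2 * (ℓ ∸ 2))
mainTheorem2 (suc (suc L)) (suc (suc t₀)) _ _ r (ramsey , _) n G no-clique =
  square-bound (suc n) r (indepCount t G) L (suc t₀) (monochromaticCount true t)
               (monochromaticCount-squared true t)
               (subst (λ I → _ ≤ r ^ t * (I ^ L * monochromaticCount true t)) independentCount≡indepCount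
                      (ramsey-bound no-clique ramsey))
  where
  open DoubleCounting G r t₀ L
  t : ℕ
  t = suc (suc t₀)
mainTheorem2 zero          _             ()        _  _ _ _ _ _
mainTheorem2 (suc zero)    _             (s≤s ()) _  _ _ _ _ _
mainTheorem2 (suc (suc _)) zero          _  ()        _ _ _ _ _
mainTheorem2 (suc (suc _)) (suc zero)    _  (s≤s ())  _ _ _ _ _
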